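{- If $M,N\in\mathcal E_3$ and $\chi(M)\ge\dim(N)+4$, then $M$ contains $N$ as an induced restriction.
   Context: A simple binary matroid (here just "matroid") is a pair $M=(E,G)$, where $G$ is identified with $\mathbb F_2^n\setminus\{0\}$ and $E\subseteq G$; $\dim(M)=n$. A flat of $G$ is a set $V\setminus\{0\}$ with $V$ a subspace, of dimension $\dim V$. $M$ contains $N=(E',G')$ as an induced restriction if there is an injective linear map $\varphi:G'\to G$ (linear on the underlying vector spaces) with $\varphi(E')=E\cap\varphi(G')$. The critical number $\chi(M)$ is the smallest $k\ge0$ such that $G\setminus E$ contains a flat of dimension $n-k$. $\mathcal E_3$ is the class of matroids $(E,G)$ with $|E\cap F|$ even for every flat $F$ of dimension at least $3$. -}

module Defs where

open import Data.Bool using (Bool; true; false; if_then_else_; _xor_)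
open import Data.Nat using (ℕ; zero; suc; _<_; _≤_; _∸_)
open import Data.Nat.Divisibility using (_∣_)
open import Data.Vec using (Vec; []; _∷_; replicate; zipWith)
open import Data.List using (List; []; _∷_; map; _++_; length; filter)
open import Data.Product using (Σ; _×_; ∃-syntax)
open import Relation.Binary.PropositionalEquality using (_≡_)
open import Relation.Nullary using (¬_)
open import Function.Definitions using (Injective)

-- Vectors of F₂ⁿ are Vec Bool n (true = 1); addition is pointwise xor.
F₂^ : ℕ → Set
F₂^ n = Vec Bool n

0v : ∀ {n} → F₂^ n
0v = replicate _ false

_⊕_ : ∀ {n} → F₂^ n → F₂^ n → F₂^ n
_⊕_ = zipWith _xor_

-- A linear map F₂ᵏ → F₂ⁿ, given by the images of the k standard basis vectors.
LinMap : ℕ → ℕ → Set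
LinMap k n = Vec (F₂^ n) k

apply : ∀ {k n} → LinMap k n → F₂^ k → F₂^ n
apply []       []       = 0v
apply (v ∷ vs) (b ∷ bs) = if b then v ⊕ apply vs bs else apply vs bs

allVecs : (k : ℕ) → List (F₂^ k)
allVecs zero    = [] ∷ []
allVecs (suc k) = map (false ∷_) (allVecs k) ++ map (true ∷_) (allVecs k)

-- A simple binary matroid (E, G) with G = F₂ⁿ ∖ {0}; E is given by its
-- (decidable) indicator function on F₂ⁿ, required to vanish at 0.
record Matroid : Set where
  field
    dim   : ℕ
    E     : F₂^ dim → Bool
    E-0   : E 0v ≡ false
open Matroid public

-- |E ∩ F| where F = φ(F₂ᵏ)∖{0} is the flat of dimension k that is the image
-- of the injective linear map φ (every flat of dimension k arises this way).
countIn : (M : Matroid) → ∀ {k} → LinMap k (dim M) → ℕ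
countIn M {k} A = length (filter (λ x → Data.Bool._≟_ (E M (apply A x)) true) (allVecs k))

Avoids : (M : Matroid) → ∀ {k} → LinMap k (dim M) → Set
Avoids M {k} A = (x : F₂^ k) → E M (apply A x) ≡ false

HasAvoidingFlat : Matroid → ℕ → Set
HasAvoidingFlat M m =
  Σ (LinMap m (dim M)) λ A → Injective _≡_ _≡_ (apply A) × Avoids M A

IsCriticalNumber : Matroid → ℕ → Set
IsCriticalNumber M c =
  c ≤ dim M × HasAvoidingFlat M (dim M ∸ c) ×
  ((j : ℕ) → j < c → ¬ HasAvoidingFlat M (dim M ∸ j))

InE3 : Matroid → Set
InE3 M = (k : ℕ) → 3 ≤ k → (A : LinMap k (dim M)) →
  Injective _≡_ _≡_ (apply A) → 2 ∣ countIn M A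

InducedRestriction : (N M : Matroid) → Set
InducedRestriction N M =
  Σ (LinMap (dim N) (dim M)) λ A → Injective _≡_ _≡_ (apply A) ×
    ((x : F₂^ (dim N)) → ¬ x ≡ 0v → E N x ≡ E M (apply A x))

-- An 𝓔₃ indicator f is a quadratic form over F₂. With the polar form B x y = f (x ⊕ y) + f x + f y,
-- the sum B x (y ⊕ z) + B x y + B x z is the sum of f over the span of x, y, z, which vanishes: by the
-- 𝓔₃ parity when x, y, z are independent, and by pairing a with a ⊕ v for a kernel vector v otherwise.
-- A quadratic form F on F₂ⁿ that vanishes on no m-dimensional subspace, with m ≤ n − 2, has a hyperbolic
-- pair: zeros x, y with B x y = 1. In coordinates (s, t, w) adapted to x, y and their B-orthogonal
-- complement, F = s t + F′ w, where F′ vanishes on no (m − 1)-dimensional subspace. By induction on k,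
-- F then represents every quadratic g on F₂ᵏ once k + m < n: represent g on the hyperplane of vectors
-- false ∷ a by F′, and send the remaining basis vector to x ⊕ g(e₀) y, correcting the y-coordinate by the
-- polar form of g. For M, the critical number forbids subspaces of dimension dim M − dim N − 1 on which E
-- vanishes.

module Submission where

open import Defs
open import Algebra.Solver.Ring.AlmostCommutativeRing using (fromCommutativeRing)
import Algebra.Solver.Ring.Simple as RingSolver
open import Data.Bool using (Bool; true; false; not; _∧_; _xor_; if_then_else_)
open import Data.Bool.Properties
  using (xor-assoc; xor-comm; xor-identityˡ; xor-identityʳ; xor-same; not-involutive;
         ∧-distribʳ-xor; ∧-zeroʳ; ∧-identityʳ; ¬-not; xor-∧-commutativeRing)
  renaming (_≟_ to _≟ᵇ_)
open import Data.Empty using (⊥-elim)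
open import Data.List using (List; []; _∷_; _++_; map; length; filter; foldr)
open import Data.List.Properties using (foldr-map)
open import Data.Nat using (ℕ; zero; suc; _+_; _*_; _≤_; _∸_; z≤n; s≤s)
open import Data.Nat.Divisibility using (_∣_; divides)
open import Data.Nat.Properties
  using (≤-trans; ≤-reflexive; n≤1+n; m≤n+m; +-suc; +-comm; m+[n∸m]≡n; +-monoʳ-≤)
open import Data.Product using (Σ; ∃; _×_; _,_; proj₂)
open import Data.Sum using (_⊎_; inj₁; inj₂)
open import Data.Vec using ([]; _∷_)
open import Data.Vec.Properties
  using (∷-injectiveˡ; ∷-injectiveʳ; ≡-dec; zipWith-assoc; zipWith-comm; zipWith-identityˡ; zipWith-identityʳ)
open import Function using (_∘_)
open import Function.Definitions using (Injective)
open import Relation.Binary.PropositionalEquality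
open import Relation.Nullary using (¬_; Dec; yes; no)
open import Relation.Nullary.Decidable using (map′; _⊎-dec_; _×-dec_; ¬?; decidable-stable)
open import Relation.Unary using (Decidable)

open RingSolver (fromCommutativeRing xor-∧-commutativeRing) _≟ᵇ_ using (solve; _:+_; _:*_; _:=_; con)

xor-interchange : ∀ p q r s → (p xor q) xor (r xor s) ≡ (p xor r) xor (q xor s)
xor-interchange = solve 4 (λ p q r s → (p :+ q) :+ (r :+ s) := (p :+ r) :+ (q :+ s)) refl

xor≡false⇒≡ : ∀ {a b} → a xor b ≡ false → a ≡ b
xor≡false⇒≡ {false} {false} _ = refl
xor≡false⇒≡ {true}  {true}  _ = refl

infixr 25 _·_

_·_ : ∀ {n} → Bool → F₂^ n → F₂^ n
b · x = if b then x else 0v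

_≟_ : ∀ {n} → (u v : F₂^ n) → Dec (u ≡ v)
_≟_ = ≡-dec _≟ᵇ_

⊕-assoc : ∀ {n} (u v w : F₂^ n) → (u ⊕ v) ⊕ w ≡ u ⊕ (v ⊕ w)
⊕-assoc = zipWith-assoc xor-assoc

⊕-comm : ∀ {n} (u v : F₂^ n) → u ⊕ v ≡ v ⊕ u
⊕-comm = zipWith-comm xor-comm

⊕-identityˡ : ∀ {n} (u : F₂^ n) → 0v ⊕ u ≡ u
⊕-identityˡ = zipWith-identityˡ xor-identityˡ

⊕-identityʳ : ∀ {n} (u : F₂^ n) → u ⊕ 0v ≡ u
⊕-identityʳ = zipWith-identityʳ xor-identityʳ

⊕-self : ∀ {n} (u : F₂^ n) → u ⊕ u ≡ 0v
⊕-self []      = refl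
⊕-self (a ∷ u) = cong₂ _∷_ (xor-same a) (⊕-self u)

⊕-interchange : ∀ {n} (u v w x : F₂^ n) → (u ⊕ v) ⊕ (w ⊕ x) ≡ (u ⊕ w) ⊕ (v ⊕ x)
⊕-interchange []      []      []      []      = refl
⊕-interchange (a ∷ u) (b ∷ v) (c ∷ w) (d ∷ x) = cong₂ _∷_ (xor-interchange a b c d) (⊕-interchange u v w x)

⊕≡0⇒≡ : ∀ {n} {u v : F₂^ n} → u ⊕ v ≡ 0v → u ≡ v
⊕≡0⇒≡ {u = u} {v} eq = begin
  u             ≡⟨ sym (⊕-identityʳ u) ⟩
  u ⊕ 0v        ≡⟨ cong (u ⊕_) (sym (⊕-self v)) ⟩
  u ⊕ (v ⊕ v)   ≡⟨ sym (⊕-assoc u v v) ⟩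
  (u ⊕ v) ⊕ v   ≡⟨ cong (_⊕ v) eq ⟩
  0v ⊕ v        ≡⟨ ⊕-identityˡ v ⟩
  v             ∎
  where open ≡-Reasoning

·-distribʳ : ∀ {n} (b c : Bool) (x : F₂^ n) → (b xor c) · x ≡ b · x ⊕ c · x
·-distribʳ false c    x = sym (⊕-identityˡ (c · x))
·-distribʳ true  false x = sym (⊕-identityʳ x)
·-distribʳ true  true  x = sym (⊕-self x)

∃? : ∀ {k} {P : F₂^ k → Set} → Decidable P → Dec (∃ P)
∃? {zero}  P? = map′ ([] ,_) (λ { ([] , p) → p }) (P? [])
∃? {suc k} P? = map′ join split (∃? (P? ∘ (false ∷_)) ⊎-dec ∃? (P? ∘ (true ∷_)))
  where
  join : _ ⊎ _ → ∃ _
  join (inj₁ (v , p)) = false ∷ v , p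
  join (inj₂ (v , p)) = true ∷ v , p
  split : ∃ _ → _ ⊎ _
  split (false ∷ v , p) = inj₁ (v , p)
  split (true ∷ v , p)  = inj₂ (v , p)

true-or-all-false : ∀ {k} (g : F₂^ k → Bool) → (∃ λ a → g a ≡ true) ⊎ (∀ a → g a ≡ false)
true-or-all-false g with ∃? (λ a → g a ≟ᵇ true)
... | yes witness = inj₁ witness
... | no none     = inj₂ λ a → ¬-not λ ga → none (a , ga)

Linear : ∀ {k n} → (F₂^ k → F₂^ n) → Set
Linear φ = ∀ u v → φ (u ⊕ v) ≡ φ u ⊕ φ v

Additive : ∀ {k} → (F₂^ k → Bool) → Set
Additive h = ∀ u v → h (u ⊕ v) ≡ h u xor h v

linear-0 : ∀ {k n} {φ : F₂^ k → F₂^ n} → Linear φ → φ 0v ≡ 0v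
linear-0 {φ = φ} φ-lin = begin
  φ 0v          ≡⟨ cong φ (sym (⊕-self 0v)) ⟩
  φ (0v ⊕ 0v)   ≡⟨ φ-lin 0v 0v ⟩
  φ 0v ⊕ φ 0v   ≡⟨ ⊕-self (φ 0v) ⟩
  0v            ∎
  where open ≡-Reasoning

additive-0 : ∀ {k} (h : F₂^ k → Bool) → Additive h → h 0v ≡ false
additive-0 h h-add = trans (cong h (sym (⊕-self 0v))) (trans (h-add 0v 0v) (xor-same (h 0v)))

additive-· : ∀ {k} (h : F₂^ k → Bool) → Additive h → ∀ b x → h (b · x) ≡ b ∧ h x
additive-· h h-add true  x = refl
additive-· h h-add false x = additive-0 h h-add

additive-∘ : ∀ {k n} {h : F₂^ n → Bool} → Additive h → {φ : F₂^ k → F₂^ n} → Linear φ →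
  Additive (h ∘ φ)
additive-∘ {h = h} h-add {φ} φ-lin u v = trans (cong h (φ-lin u v)) (h-add (φ u) (φ v))

trivialKernel⇒injective : ∀ {k n} {φ : F₂^ k → F₂^ n} → Linear φ → (∀ v → φ v ≡ 0v → v ≡ 0v) →
  Injective _≡_ _≡_ φ
trivialKernel⇒injective {φ = φ} φ-lin ker {u} {v} φu≡φv =
  ⊕≡0⇒≡ (ker (u ⊕ v) (trans (φ-lin u v) (trans (cong (_⊕ φ v) φu≡φv) (⊕-self (φ v)))))

injective⇒trivialKernel : ∀ {k n} {φ : F₂^ k → F₂^ n} → Linear φ → Injective _≡_ _≡_ φ →
  ∀ {v} → φ v ≡ 0v → v ≡ 0v
injective⇒trivialKernel φ-lin φ-inj φv≡0 = φ-inj (trans φv≡0 (sym (linear-0 φ-lin)))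

infixr 5 _◃_

_◃_ : ∀ {k n} → F₂^ n → (F₂^ k → F₂^ n) → F₂^ (suc k) → F₂^ n
(w ◃ ψ) (b ∷ a) = b · w ⊕ ψ a

◃-linear : ∀ {k n} (w : F₂^ n) {ψ : F₂^ k → F₂^ n} → Linear ψ → Linear (w ◃ ψ)
◃-linear w {ψ} ψ-lin (b ∷ u) (c ∷ v) = begin
  (b xor c) · w ⊕ ψ (u ⊕ v)          ≡⟨ cong₂ _⊕_ (·-distribʳ b c w) (ψ-lin u v) ⟩
  (b · w ⊕ c · w) ⊕ (ψ u ⊕ ψ v)      ≡⟨ ⊕-interchange (b · w) (c · w) (ψ u) (ψ v) ⟩
  (b · w ⊕ ψ u) ⊕ (c · w ⊕ ψ v)      ∎
  where open ≡-Reasoning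

◃-injective : ∀ {k n} {w : F₂^ n} {ψ : F₂^ k → F₂^ n} → Linear ψ → Injective _≡_ _≡_ ψ →
  (h : F₂^ n → Bool) → Additive h → (∀ a → h (ψ a) ≡ false) → h w ≡ true →
  Injective _≡_ _≡_ (w ◃ ψ)
◃-injective {w = w} {ψ} ψ-lin ψ-inj h h-add h-ψ hw = trivialKernel⇒injective (◃-linear w ψ-lin) ker
  where
  ker : ∀ v → (w ◃ ψ) v ≡ 0v → v ≡ 0v
  ker (b ∷ a) eq = cong₂ _∷_ b≡false (injective⇒trivialKernel ψ-lin ψ-inj ψa≡0)
    where
    b≡false : b ≡ false
    b≡false = begin
      b                        ≡⟨ solve 1 (λ b → b := (b :* con true) :+ con false) refl b ⟩
      (b ∧ true) xor false     ≡⟨ sym (cong₂ (λ s t → (b ∧ s) xor t) hw (h-ψ a)) ⟩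
      (b ∧ h w) xor h (ψ a)    ≡⟨ sym (cong (_xor h (ψ a)) (additive-· h h-add b w)) ⟩
      h (b · w) xor h (ψ a)    ≡⟨ sym (h-add (b · w) (ψ a)) ⟩
      h (b · w ⊕ ψ a)          ≡⟨ cong h eq ⟩
      h 0v                     ≡⟨ additive-0 h h-add ⟩
      false                    ∎
      where open ≡-Reasoning
    ψa≡0 : ψ a ≡ 0v
    ψa≡0 = trans (sym (⊕-identityˡ (ψ a))) (trans (cong (λ c → c · w ⊕ ψ a) (sym b≡false)) eq)

apply-◃ : ∀ {k n} (w : F₂^ n) (ws : LinMap k n) (v : F₂^ (suc k)) → apply (w ∷ ws) v ≡ (w ◃ apply ws) v
apply-◃ w ws (true ∷ bs)  = refl
apply-◃ w ws (false ∷ bs) = sym (⊕-identityˡ (apply ws bs))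

apply-linear : ∀ {k n} (A : LinMap k n) → Linear (apply A)
apply-linear []       []       []       = sym (⊕-self 0v)
apply-linear (w ∷ ws) u v = begin
  apply (w ∷ ws) (u ⊕ v)                         ≡⟨ apply-◃ w ws (u ⊕ v) ⟩
  (w ◃ apply ws) (u ⊕ v)                         ≡⟨ ◃-linear w (apply-linear ws) u v ⟩
  (w ◃ apply ws) u ⊕ (w ◃ apply ws) v            ≡⟨ sym (cong₂ _⊕_ (apply-◃ w ws u) (apply-◃ w ws v)) ⟩
  apply (w ∷ ws) u ⊕ apply (w ∷ ws) v            ∎
  where open ≡-Reasoning

columns : ∀ {k n} → (F₂^ k → F₂^ n) → LinMap k n
columns {zero}  φ = []
columns {suc k} φ = φ (true ∷ 0v) ∷ columns (φ ∘ (false ∷_))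

apply-columns : ∀ {k n} {φ : F₂^ k → F₂^ n} → Linear φ → ∀ a → apply (columns φ) a ≡ φ a
apply-columns {zero}  φ-lin []           = sym (linear-0 φ-lin)
apply-columns {suc k} φ-lin (false ∷ a)  = apply-columns (λ u v → φ-lin (false ∷ u) (false ∷ v)) a
apply-columns {suc k} {φ = φ} φ-lin (true ∷ a) = begin
  φ (true ∷ 0v) ⊕ apply (columns (φ ∘ (false ∷_))) a
    ≡⟨ cong (φ (true ∷ 0v) ⊕_) (apply-columns (λ u v → φ-lin (false ∷ u) (false ∷ v)) a) ⟩
  φ (true ∷ 0v) ⊕ φ (false ∷ a)   ≡⟨ sym (φ-lin (true ∷ 0v) (false ∷ a)) ⟩
  φ (true ∷ (0v ⊕ a))             ≡⟨ cong (φ ∘ (true ∷_)) (⊕-identityˡ a) ⟩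
  φ (true ∷ a)                    ∎
  where open ≡-Reasoning

record _↪_ (k n : ℕ) : Set where
  field
    ⟦_⟧       : F₂^ k → F₂^ n
    linear    : Linear ⟦_⟧
    injective : Injective _≡_ _≡_ ⟦_⟧
open _↪_ public

infixr 9 _∘ₑ_

_∘ₑ_ : ∀ {k m n} → m ↪ n → k ↪ m → k ↪ n
φ ∘ₑ ψ = record
  { ⟦_⟧       = ⟦ φ ⟧ ∘ ⟦ ψ ⟧
  ; linear    = λ u v → trans (cong ⟦ φ ⟧ (linear ψ u v)) (linear φ (⟦ ψ ⟧ u) (⟦ ψ ⟧ v))
  ; injective = injective ψ ∘ injective φ
  }

idₑ : ∀ {n} → n ↪ n
idₑ = record { ⟦_⟧ = λ v → v ; linear = λ _ _ → refl ; injective = λ eq → eq }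

liftₑ : ∀ {k n} → k ↪ n → suc k ↪ suc n
liftₑ ψ = record
  { ⟦_⟧       = λ { (b ∷ a) → b ∷ ⟦ ψ ⟧ a }
  ; linear    = λ { (b ∷ u) (c ∷ v) → cong ((b xor c) ∷_) (linear ψ u v) }
  ; injective = λ { {b ∷ u} {c ∷ v} eq → cong₂ _∷_ (∷-injectiveˡ eq) (injective ψ (∷-injectiveʳ eq)) }
  }

pad : ∀ {m n} → m ≤ n → m ↪ n
pad z≤n       = record
  { ⟦_⟧ = λ _ → 0v ; linear = λ _ _ → sym (⊕-self 0v) ; injective = λ { {[]} {[]} _ → refl } }
pad (s≤s m≤n) = liftₑ (pad m≤n)

extend : ∀ {k n} (ℓ : F₂^ (suc k) → Bool) → Additive ℓ → k ↪ n → suc k ↪ suc (suc n)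
extend ℓ ℓ-add ψ = record
  { ⟦_⟧       = λ { (b ∷ a) → b ∷ ℓ (b ∷ a) ∷ ⟦ ψ ⟧ a }
  ; linear    = λ { (b ∷ u) (c ∷ v) →
      cong₂ (λ s t → (b xor c) ∷ s ∷ t) (ℓ-add (b ∷ u) (c ∷ v)) (linear ψ u v) }
  ; injective = λ { {b ∷ u} {c ∷ v} eq →
      cong₂ _∷_ (∷-injectiveˡ eq) (injective ψ (∷-injectiveʳ (∷-injectiveʳ eq))) }
  }

toLinMap : ∀ {k n} (φ : k ↪ n) →
  Σ (LinMap k n) λ A → Injective _≡_ _≡_ (apply A) × (∀ a → apply A a ≡ ⟦ φ ⟧ a)
toLinMap φ = columns ⟦ φ ⟧ , A-injective , apply-columns (linear φ)
  where
  A-injective : Injective _≡_ _≡_ (apply (columns ⟦ φ ⟧))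
  A-injective {u} {v} eq =
    injective φ (trans (sym (apply-columns (linear φ) u)) (trans eq (apply-columns (linear φ) v)))

-- Xor sums over F₂ᵏ

⨁ : ∀ {k} → (F₂^ k → Bool) → Bool
⨁ {zero}  g = g []
⨁ {suc k} g = ⨁ (g ∘ (false ∷_)) xor ⨁ (g ∘ (true ∷_))

⨁-cong : ∀ {k} {g h : F₂^ k → Bool} → (∀ a → g a ≡ h a) → ⨁ g ≡ ⨁ h
⨁-cong {zero}  g≗h = g≗h []
⨁-cong {suc k} g≗h = cong₂ _xor_ (⨁-cong (g≗h ∘ (false ∷_))) (⨁-cong (g≗h ∘ (true ∷_)))

⨁-translate : ∀ {k} (g : F₂^ k → Bool) (w : F₂^ k) → ⨁ (λ a → g (a ⊕ w)) ≡ ⨁ g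
⨁-translate g []          = refl
⨁-translate g (false ∷ w) =
  cong₂ _xor_ (⨁-translate (g ∘ (false ∷_)) w) (⨁-translate (g ∘ (true ∷_)) w)
⨁-translate g (true ∷ w)  =
  trans (cong₂ _xor_ (⨁-translate (g ∘ (true ∷_)) w) (⨁-translate (g ∘ (false ∷_)) w))
        (xor-comm (⨁ (g ∘ (true ∷_))) (⨁ (g ∘ (false ∷_))))

⨁-periodic : ∀ {k} (g : F₂^ k → Bool) (v : F₂^ k) → ¬ v ≡ 0v → (∀ a → g (a ⊕ v) ≡ g a) →
  ⨁ g ≡ false
⨁-periodic g []          v≢0 _   = ⊥-elim (v≢0 refl)
⨁-periodic g (false ∷ v) v≢0 per = cong₂ _xor_
  (⨁-periodic (g ∘ (false ∷_)) v (v≢0 ∘ cong (false ∷_)) (per ∘ (false ∷_)))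
  (⨁-periodic (g ∘ (true ∷_))  v (v≢0 ∘ cong (false ∷_)) (per ∘ (true ∷_)))
⨁-periodic g (true ∷ v)  _   per = begin
  g₀ xor ⨁ (g ∘ (true ∷_))                  ≡⟨ cong (g₀ xor_) (sym (⨁-translate (g ∘ (true ∷_)) v)) ⟩
  g₀ xor ⨁ (λ a → g (true ∷ (a ⊕ v)))       ≡⟨ cong (g₀ xor_) (⨁-cong (per ∘ (false ∷_))) ⟩
  g₀ xor g₀                                 ≡⟨ xor-same g₀ ⟩
  false                                     ∎
  where
  open ≡-Reasoning
  g₀ = ⨁ (g ∘ (false ∷_))

xorSum : ∀ {A : Set} → (A → Bool) → List A → Bool
xorSum g = foldr (λ x b → g x xor b) false

xorSum-++ : ∀ {A : Set} (g : A → Bool) xs ys → xorSum g (xs ++ ys) ≡ xorSum g xs xor xorSum g ys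
xorSum-++ g []       ys = refl
xorSum-++ g (x ∷ xs) ys = trans (cong (g x xor_) (xorSum-++ g xs ys)) (sym (xor-assoc (g x) _ _))

xorSum-allVecs : ∀ {k} (g : F₂^ k → Bool) → xorSum g (allVecs k) ≡ ⨁ g
xorSum-allVecs {zero}  g = xor-identityʳ (g [])
xorSum-allVecs {suc k} g = begin
  xorSum g (map (false ∷_) (allVecs k) ++ map (true ∷_) (allVecs k))
    ≡⟨ xorSum-++ g (map (false ∷_) (allVecs k)) (map (true ∷_) (allVecs k)) ⟩
  xorSum g (map (false ∷_) (allVecs k)) xor xorSum g (map (true ∷_) (allVecs k))
    ≡⟨ cong₂ _xor_ (foldr-map _ (false ∷_) false (allVecs k)) (foldr-map _ (true ∷_) false (allVecs k)) ⟩
  xorSum (g ∘ (false ∷_)) (allVecs k) xor xorSum (g ∘ (true ∷_)) (allVecs k)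
    ≡⟨ cong₂ _xor_ (xorSum-allVecs (g ∘ (false ∷_))) (xorSum-allVecs (g ∘ (true ∷_))) ⟩
  ⨁ (g ∘ (false ∷_)) xor ⨁ (g ∘ (true ∷_))
    ∎
  where open ≡-Reasoning

odd : ℕ → Bool
odd zero    = false
odd (suc n) = not (odd n)

even⇒¬odd : ∀ {n} → 2 ∣ n → odd n ≡ false
even⇒¬odd (divides q refl) = odd-double q
  where
  odd-double : ∀ q → odd (q * 2) ≡ false
  odd-double zero    = refl
  odd-double (suc q) = trans (not-involutive (odd (q * 2))) (odd-double q)

odd-count : ∀ {A : Set} (g : A → Bool) xs → odd (length (filter (λ x → g x ≟ᵇ true) xs)) ≡ xorSum g xs
odd-count g []       = refl
odd-count g (x ∷ xs) with g x
... | true  = cong not (odd-count g xs)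
... | false = odd-count g xs

odd-countIn : (M : Matroid) {k : ℕ} (A : LinMap k (dim M)) → odd (countIn M A) ≡ ⨁ (E M ∘ apply A)
odd-countIn M A = trans (odd-count (E M ∘ apply A) (allVecs _)) (xorSum-allVecs (E M ∘ apply A))

-- Quadratic forms

polar : ∀ {n} → (F₂^ n → Bool) → F₂^ n → F₂^ n → Bool
polar F x y = F (x ⊕ y) xor F x xor F y

record IsQuadratic {n} (F : F₂^ n → Bool) : Set where
  field
    vanishes-0     : F 0v ≡ false
    polar-additive : ∀ x → Additive (polar F x)
open IsQuadratic public

∘-quadratic : ∀ {k n} {F : F₂^ n → Bool} → IsQuadratic F → {φ : F₂^ k → F₂^ n} → Linear φ →
  IsQuadratic (F ∘ φ)
∘-quadratic {F = F} F-quad {φ} φ-lin = record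
  { vanishes-0     = trans (cong F (linear-0 φ-lin)) (vanishes-0 F-quad)
  ; polar-additive = λ u v w → begin
      polar (F ∘ φ) u (v ⊕ w)                       ≡⟨ polar-∘ u (v ⊕ w) ⟩
      polar F (φ u) (φ (v ⊕ w))                     ≡⟨ cong (polar F (φ u)) (φ-lin v w) ⟩
      polar F (φ u) (φ v ⊕ φ w)                     ≡⟨ polar-additive F-quad (φ u) (φ v) (φ w) ⟩
      polar F (φ u) (φ v) xor polar F (φ u) (φ w)   ≡⟨ cong₂ _xor_ (polar-∘ u v) (polar-∘ u w) ⟨
      polar (F ∘ φ) u v xor polar (F ∘ φ) u w       ∎
  }
  where
  open ≡-Reasoning
  polar-∘ : ∀ u v → polar (F ∘ φ) u v ≡ polar F (φ u) (φ v)
  polar-∘ u v = cong (λ t → F t xor F (φ u) xor F (φ v)) (φ-lin u v)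

⨁-span₃ : ∀ {n} (F : F₂^ n → Bool) → F 0v ≡ false → ∀ x y z →
  ⨁ (F ∘ apply (x ∷ y ∷ z ∷ [])) ≡
    (F z xor (F y xor F (y ⊕ z))) xor ((F x xor F (x ⊕ z)) xor (F (x ⊕ y) xor F (x ⊕ (y ⊕ z))))
⨁-span₃ F F0 x y z rewrite ⊕-identityʳ x | ⊕-identityʳ y | ⊕-identityʳ z | F0 = refl

polar-additive-from-span : ∀ {n} (F : F₂^ n → Bool) → F 0v ≡ false → ∀ x y z →
  ⨁ (F ∘ apply (x ∷ y ∷ z ∷ [])) ≡ false → polar F x (y ⊕ z) ≡ polar F x y xor polar F x z
polar-additive-from-span F F0 x y z span≡0 = begin
  polar F x (y ⊕ z)
    ≡⟨ identity (F x) (F y) (F z) (F (x ⊕ y)) (F (x ⊕ z)) (F (y ⊕ z)) (F (x ⊕ (y ⊕ z))) ⟩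
  (polar F x y xor polar F x z) xor span
    ≡⟨ cong ((polar F x y xor polar F x z) xor_) (trans (sym (⨁-span₃ F F0 x y z)) span≡0) ⟩
  (polar F x y xor polar F x z) xor false
    ≡⟨ xor-identityʳ (polar F x y xor polar F x z) ⟩
  polar F x y xor polar F x z
    ∎
  where
  open ≡-Reasoning
  span : Bool
  span = (F z xor (F y xor F (y ⊕ z))) xor ((F x xor F (x ⊕ z)) xor (F (x ⊕ y) xor F (x ⊕ (y ⊕ z))))
  identity : ∀ a b c d e g h → h xor (a xor g) ≡
    ((d xor (a xor b)) xor (e xor (a xor c))) xor ((c xor (b xor g)) xor ((a xor e) xor (d xor h)))
  identity = solve 7 (λ a b c d e g h → h :+ (a :+ g) :=
    ((d :+ (a :+ b)) :+ (e :+ (a :+ c))) :+ ((c :+ (b :+ g)) :+ ((a :+ e) :+ (d :+ h)))) refl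

InE3⇒⨁-span-vanishes : (M : Matroid) → InE3 M → (A : LinMap 3 (dim M)) → ⨁ (E M ∘ apply A) ≡ false
InE3⇒⨁-span-vanishes M M-E3 A with ∃? (λ v → ¬? (v ≟ 0v) ×-dec (apply A v ≟ 0v))
... | yes (v , v≢0 , Av≡0) = ⨁-periodic (E M ∘ apply A) v v≢0 λ a →
  cong (E M) (trans (apply-linear A a v) (trans (cong (apply A a ⊕_) Av≡0) (⊕-identityʳ (apply A a))))
... | no no-kernel = trans (sym (odd-countIn M A)) (even⇒¬odd (M-E3 3 (s≤s (s≤s (s≤s z≤n))) A A-injective))
  where
  A-injective : Injective _≡_ _≡_ (apply A)
  A-injective = trivialKernel⇒injective (apply-linear A) λ v Av≡0 →
    decidable-stable (v ≟ 0v) λ v≢0 → no-kernel (v , v≢0 , Av≡0)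

InE3⇒quadratic : (M : Matroid) → InE3 M → IsQuadratic (E M)
InE3⇒quadratic M M-E3 = record
  { vanishes-0     = E-0 M
  ; polar-additive = λ x y z →
      polar-additive-from-span (E M) (E-0 M) x y z (InE3⇒⨁-span-vanishes M M-E3 (x ∷ y ∷ z ∷ []))
  }

-- Kernels of linear functionals

record Kernel {e} (h : F₂^ (suc e) → Bool) : Set where
  field
    embedding   : e ↪ suc e
    annihilated : ∀ a → h (⟦ embedding ⟧ a) ≡ false
    exhausts    : ∀ {v} → h v ≡ false → ∃ λ a → ⟦ embedding ⟧ a ≡ v

additive-∷ : ∀ {e} (h : F₂^ (suc e) → Bool) → Additive h →
  ∀ c a → h (c ∷ a) ≡ (c ∧ h (true ∷ 0v)) xor h (false ∷ a)
additive-∷ h h-add c a = begin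
  h (c ∷ a)                              ≡⟨ cong₂ (λ b v → h (b ∷ v)) (xor-identityʳ c) (⊕-identityˡ a) ⟨
  h ((c ∷ 0v) ⊕ (false ∷ a))             ≡⟨ h-add (c ∷ 0v) (false ∷ a) ⟩
  h (c ∷ 0v) xor h (false ∷ a)           ≡⟨ cong (_xor h (false ∷ a)) (on-axis c) ⟩
  (c ∧ h (true ∷ 0v)) xor h (false ∷ a)  ∎
  where
  open ≡-Reasoning
  on-axis : ∀ c → h (c ∷ 0v) ≡ c ∧ h (true ∷ 0v)
  on-axis true  = refl
  on-axis false = additive-0 h h-add

kernel-pivot : ∀ {e} {h : F₂^ (suc e) → Bool} → Additive h → h (true ∷ 0v) ≡ true → Kernel h
kernel-pivot {h = h} h-add pivot = record
  { embedding   = record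
    { ⟦_⟧       = λ a → h (false ∷ a) ∷ a
    ; linear    = λ u v → cong (_∷ (u ⊕ v)) (h-add (false ∷ u) (false ∷ v))
    ; injective = ∷-injectiveʳ
    }
  ; annihilated = λ a → begin
      h (h (false ∷ a) ∷ a)                                  ≡⟨ h-∷ (h (false ∷ a)) a ⟩
      (h (false ∷ a) ∧ true) xor h (false ∷ a)
        ≡⟨ solve 1 (λ b → (b :* con true) :+ b := con false) refl (h (false ∷ a)) ⟩
      false                                                  ∎
  ; exhausts    = λ { {c ∷ a} hv → a , cong (_∷ a) (sym (begin
      c                     ≡⟨ ∧-identityʳ c ⟨
      c ∧ true              ≡⟨ xor≡false⇒≡ (trans (sym (h-∷ c a)) hv) ⟩
      h (false ∷ a)         ∎)) }
  }
  where
  open ≡-Reasoning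
  h-∷ : ∀ c a → h (c ∷ a) ≡ (c ∧ true) xor h (false ∷ a)
  h-∷ c a = trans (additive-∷ h h-add c a) (cong (λ t → (c ∧ t) xor h (false ∷ a)) pivot)

ignores-head : ∀ {e} (h : F₂^ (suc e) → Bool) → Additive h → h (true ∷ 0v) ≡ false →
  ∀ c a → h (c ∷ a) ≡ h (false ∷ a)
ignores-head h h-add pivot c a = begin
  h (c ∷ a)                              ≡⟨ additive-∷ h h-add c a ⟩
  (c ∧ h (true ∷ 0v)) xor h (false ∷ a)  ≡⟨ cong (λ t → (c ∧ t) xor h (false ∷ a)) pivot ⟩
  (c ∧ false) xor h (false ∷ a)          ≡⟨ cong (_xor h (false ∷ a)) (∧-zeroʳ c) ⟩
  h (false ∷ a)                          ∎
  where open ≡-Reasoning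

kernel : ∀ {e} {h : F₂^ (suc e) → Bool} → Additive h → ∀ {z} → h z ≡ true → Kernel h

kernel-shift : ∀ {e} {h : F₂^ (suc e) → Bool} → Additive h → h (true ∷ 0v) ≡ false →
  ∀ {z} → h z ≡ true → Kernel h
kernel-shift {zero}  {h} h-add pivot {b ∷ []} hz
  with () ← trans (sym hz) (trans (ignores-head h h-add pivot b []) (additive-0 h h-add))
kernel-shift {suc e} {h} h-add pivot {b ∷ z} hz = record
  { embedding   = liftₑ (Kernel.embedding K)
  ; annihilated = λ { (c ∷ a) → trans (ignores-head h h-add pivot c _) (Kernel.annihilated K a) }
  ; exhausts    = λ { {c ∷ a} hv →
      let w , ιw≡a = Kernel.exhausts K (trans (sym (ignores-head h h-add pivot c a)) hv)
      in  c ∷ w , cong (c ∷_) ιw≡a }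
  }
  where
  K : Kernel (h ∘ (false ∷_))
  K = kernel (λ u v → h-add (false ∷ u) (false ∷ v)) (trans (sym (ignores-head h h-add pivot b z)) hz)

kernel {h = h} h-add hz with h (true ∷ 0v) in pivot
... | true  = kernel-pivot h-add pivot
... | false = kernel-shift h-add pivot hz

-- Hyperbolic splitting

NoVanishingSubspace : ∀ {n} → (F₂^ n → Bool) → ℕ → Set
NoVanishingSubspace {n} F m = (U : m ↪ n) → ¬ (∀ a → F (⟦ U ⟧ a) ≡ false)

noVanishing-mono : ∀ {n m k} (F : F₂^ n → Bool) → NoVanishingSubspace F m → m ≤ k → NoVanishingSubspace F k
noVanishing-mono F noVan m≤k U U-vanishes = noVan (U ∘ₑ pad m≤k) (U-vanishes ∘ ⟦ pad m≤k ⟧)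

nonvanishing : ∀ {n m} (F : F₂^ n → Bool) → NoVanishingSubspace F m → (U : m ↪ n) →
  ∃ λ a → F (⟦ U ⟧ a) ≡ true
nonvanishing F noVan U with true-or-all-false (F ∘ ⟦ U ⟧)
... | inj₁ witness   = witness
... | inj₂ vanishes  = ⊥-elim (noVan U vanishes)

Represents : ∀ {k n} → (F₂^ n → Bool) → (F₂^ k → Bool) → Set
Represents {k} {n} F g = Σ (k ↪ n) λ φ → ∀ a → g a ≡ F (⟦ φ ⟧ a)

module QuadraticForm {n} {F : F₂^ n → Bool} (F-quad : IsQuadratic F) where

  B : F₂^ n → F₂^ n → Bool
  B = polar F

  B-additiveʳ : ∀ x → Additive (B x)
  B-additiveʳ = polar-additive F-quad

  B-sym : ∀ x y → B x y ≡ B y x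
  B-sym x y = cong₂ _xor_ (cong F (⊕-comm x y)) (xor-comm (F x) (F y))

  B-additiveˡ : ∀ z x y → B (x ⊕ y) z ≡ B x z xor B y z
  B-additiveˡ z x y = trans (B-sym (x ⊕ y) z) (trans (B-additiveʳ z x y) (cong₂ _xor_ (B-sym z x) (B-sym z y)))

  B-alternating : ∀ x → B x x ≡ false
  B-alternating x = trans (cong (_xor (F x xor F x)) (trans (cong F (⊕-self x)) (vanishes-0 F-quad))) (xor-same (F x))

  B-·ʳ : ∀ z b x → B z (b · x) ≡ b ∧ B z x
  B-·ʳ z = additive-· (B z) (B-additiveʳ z)

  F-⊕ : ∀ x y → F (x ⊕ y) ≡ B x y xor (F x xor F y)
  F-⊕ x y = solve 2 (λ s r → s := (s :+ r) :+ r) refl (F (x ⊕ y)) (F x xor F y)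

  F-⊕-orthogonal : ∀ {x y} → B x y ≡ false → F (x ⊕ y) ≡ F x xor F y
  F-⊕-orthogonal {x} {y} Bxy = trans (F-⊕ x y) (cong (_xor (F x xor F y)) Bxy)

  record HyperbolicPair : Set where
    field
      x y  : F₂^ n
      F-x  : F x ≡ false
      F-y  : F y ≡ false
      B-xy : B x y ≡ true

  hyperbolicPair-from-singular : ∀ {x y} → F x ≡ false → B x y ≡ true → HyperbolicPair
  hyperbolicPair-from-singular {x} {y} F-x B-xy = by-cases (F y) refl
    where
    by-cases : ∀ b → F y ≡ b → HyperbolicPair
    by-cases false F-y = record { x = x ; y = y ; F-x = F-x ; F-y = F-y ; B-xy = B-xy }
    by-cases true  F-y = record
      { x    = x
      ; y    = x ⊕ y
      ; F-x  = F-x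
      ; F-y  = trans (F-⊕ x y) (trans (cong₂ (λ b c → b xor (c xor F y)) B-xy F-x) (cong not F-y))
      ; B-xy = trans (B-additiveʳ x x y) (cong₂ _xor_ (B-alternating x) B-xy)
      }

module Hyperbolic {e} {F : F₂^ (suc (suc e)) → Bool} (F-quad : IsQuadratic F) where
  open QuadraticForm F-quad

  record Complement (x y : F₂^ (suc (suc e))) : Set where
    field
      embedding : e ↪ suc (suc e)
      ⊥x        : ∀ a → B x (⟦ embedding ⟧ a) ≡ false
      ⊥y        : ∀ a → B y (⟦ embedding ⟧ a) ≡ false

  -- The kernel of B x contains x, on which B y does not vanish; so B y cuts it down by one more dimension.
  complement : ∀ {x y} → B x y ≡ true → Complement x y
  complement {x} {y} B-xy = record
    { embedding = Kernel.embedding K₁ ∘ₑ Kernel.embedding K₂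
    ; ⊥x        = Kernel.annihilated K₁ ∘ ⟦ Kernel.embedding K₂ ⟧
    ; ⊥y        = Kernel.annihilated K₂
    }
    where
    K₁ : Kernel (B x)
    K₁ = kernel (B-additiveʳ x) B-xy
    x∈K₁ : ∃ λ w → ⟦ Kernel.embedding K₁ ⟧ w ≡ x
    x∈K₁ = Kernel.exhausts K₁ (B-alternating x)
    K₂ : Kernel (B y ∘ ⟦ Kernel.embedding K₁ ⟧)
    K₂ = kernel (additive-∘ {h = B y} (B-additiveʳ y) (linear (Kernel.embedding K₁)))
                (trans (cong (B y) (proj₂ x∈K₁)) (trans (B-sym y x) B-xy))

  polar-nonzero : ∀ {m} → NoVanishingSubspace F m → m ≤ suc e → ∃ λ x → ∃ λ y → B x y ≡ true
  polar-nonzero {m} noVan m≤ with ∃? (λ x → ∃? (λ y → B x y ≟ᵇ true))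
  ... | yes nonzero = nonzero
  ... | no  degenerate = ⊥-elim (noVanishing-mono F noVan m≤ (Kernel.embedding K) (Kernel.annihilated K))
    where
    F-additive : Additive F
    F-additive u v = trans (F-⊕ u v) (cong (_xor (F u xor F v)) (¬-not λ Buv → degenerate (u , v , Buv)))
    K : Kernel F
    K = kernel F-additive (proj₂ (nonvanishing F (noVanishing-mono F noVan (≤-trans m≤ (n≤1+n (suc e)))) idₑ))

  -- If F x = F y = true, adding to x some w orthogonal to both with F w = true gives a zero of F.
  hyperbolicPair : ∀ {m} → NoVanishingSubspace F m → m ≤ e → HyperbolicPair
  hyperbolicPair noVan m≤e with polar-nonzero noVan (≤-trans m≤e (n≤1+n e))
  ... | x , y , B-xy = by-cases (F x) refl (F y) refl
    where
    by-cases : ∀ b → F x ≡ b → ∀ c → F y ≡ c → HyperbolicPair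
    by-cases false F-x _     _   = hyperbolicPair-from-singular F-x B-xy
    by-cases true  _   false F-y = hyperbolicPair-from-singular F-y (trans (B-sym y x) B-xy)
    by-cases true  F-x true  _   =
      let a , F-w = nonvanishing F (noVanishing-mono F noVan m≤e) embedding
      in  hyperbolicPair-from-singular (F-x⊕w a F-w) (B-[x⊕w]y a)
      where
      open Complement (complement B-xy)
      F-x⊕w : ∀ a → F (⟦ embedding ⟧ a) ≡ true → F (x ⊕ ⟦ embedding ⟧ a) ≡ false
      F-x⊕w a F-w = trans (F-⊕-orthogonal (⊥x a)) (cong₂ _xor_ F-x F-w)
      B-[x⊕w]y : ∀ a → B (x ⊕ ⟦ embedding ⟧ a) y ≡ true
      B-[x⊕w]y a = trans (B-additiveˡ y x (⟦ embedding ⟧ a)) (cong₂ _xor_ B-xy (trans (B-sym _ y) (⊥y a)))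

module Splitting {e} {F : F₂^ (suc (suc e)) → Bool} (F-quad : IsQuadratic F)
                 (P : QuadraticForm.HyperbolicPair F-quad) where
  open QuadraticForm F-quad
  open Hyperbolic F-quad
  open HyperbolicPair P
  open Complement (complement B-xy) renaming (embedding to ι)

  restriction : F₂^ e → Bool
  restriction = F ∘ ⟦ ι ⟧

  restriction-quadratic : IsQuadratic restriction
  restriction-quadratic = ∘-quadratic F-quad (linear ι)

  split : suc (suc e) ↪ suc (suc e)
  split = record
    { ⟦_⟧       = x ◃ y ◃ ⟦ ι ⟧
    ; linear    = ◃-linear x (◃-linear y (linear ι))
    ; injective = ◃-injective (◃-linear y (linear ι))
        (◃-injective (linear ι) (injective ι) (B x) (B-additiveʳ x) ⊥x B-xy)
        (B y) (B-additiveʳ y) B-y[y◃ι] (trans (B-sym y x) B-xy)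
    }
    where
    B-y[y◃ι] : ∀ v → B y ((y ◃ ⟦ ι ⟧) v) ≡ false
    B-y[y◃ι] (t ∷ a) = begin
      B y (t · y ⊕ ⟦ ι ⟧ a)              ≡⟨ B-additiveʳ y (t · y) (⟦ ι ⟧ a) ⟩
      B y (t · y) xor B y (⟦ ι ⟧ a)      ≡⟨ cong₂ _xor_ (B-·ʳ y t y) (⊥y a) ⟩
      (t ∧ B y y) xor false              ≡⟨ cong (λ b → (t ∧ b) xor false) (B-alternating y) ⟩
      (t ∧ false) xor false              ≡⟨ cong (_xor false) (∧-zeroʳ t) ⟩
      false                              ∎
      where open ≡-Reasoning

  F-y⊕ι : ∀ a → F (y ⊕ ⟦ ι ⟧ a) ≡ restriction a
  F-y⊕ι a = trans (F-⊕-orthogonal (⊥y a)) (cong (_xor restriction a) F-y)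

  F-x⊕ι : ∀ a → F (x ⊕ ⟦ ι ⟧ a) ≡ restriction a
  F-x⊕ι a = trans (F-⊕-orthogonal (⊥x a)) (cong (_xor restriction a) F-x)

  F-split : ∀ s t a → F (⟦ split ⟧ (s ∷ t ∷ a)) ≡ (s ∧ t) xor restriction a
  F-split false false a = cong F (trans (⊕-identityˡ _) (⊕-identityˡ _))
  F-split false true  a = trans (cong F (⊕-identityˡ _)) (F-y⊕ι a)
  F-split true  false a = trans (cong (F ∘ (x ⊕_)) (⊕-identityˡ _)) (F-x⊕ι a)
  F-split true  true  a = trans (F-⊕ x (y ⊕ ⟦ ι ⟧ a)) (cong₂ _xor_ B-x[y⊕ιa] (cong₂ _xor_ F-x (F-y⊕ι a)))
    where
    B-x[y⊕ιa] : B x (y ⊕ ⟦ ι ⟧ a) ≡ true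
    B-x[y⊕ιa] = trans (B-additiveʳ x y (⟦ ι ⟧ a)) (cong₂ _xor_ B-xy (⊥x a))

  restriction-noVanishing : ∀ {m} → NoVanishingSubspace F (suc m) → NoVanishingSubspace restriction m
  restriction-noVanishing noVan U U-vanishes = noVan (split ∘ₑ extend (λ _ → false) (λ _ _ → refl) U) λ where
    (b ∷ a) → trans (F-split b false (⟦ U ⟧ a))
                    (trans (cong (_xor restriction (⟦ U ⟧ a)) (∧-zeroʳ b)) (U-vanishes a))

  -- e₀ is sent to x ⊕ g(e₀)·y, and false ∷ a gets y-coordinate polar g e₀ (false ∷ a), so that F-split
  -- reproduces g (e₀ ⊕ (false ∷ a)) = polar g e₀ (false ∷ a) + g e₀ + g (false ∷ a).
  represents-suc : ∀ {k} {g : F₂^ (suc k) → Bool} → IsQuadratic g →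
    Represents restriction (g ∘ (false ∷_)) → Represents F g
  represents-suc {k} {g} g-quad (ψ , ψ-represents) = split ∘ₑ extend ℓ ℓ-additive ψ , φ-represents
    where
    e₀ : F₂^ (suc k)
    e₀ = true ∷ 0v
    ℓ : F₂^ (suc k) → Bool
    ℓ (b ∷ a) = (b ∧ g e₀) xor polar g e₀ (false ∷ a)
    ℓ-additive : Additive ℓ
    ℓ-additive (b ∷ u) (c ∷ v) =
      trans (cong₂ _xor_ (∧-distribʳ-xor (g e₀) b c) (polar-additive g-quad e₀ (false ∷ u) (false ∷ v)))
            (xor-interchange (b ∧ g e₀) (c ∧ g e₀) (polar g e₀ (false ∷ u)) (polar g e₀ (false ∷ v)))
    φ-represents : ∀ v → g v ≡ F (⟦ split ⟧ (⟦ extend ℓ ℓ-additive ψ ⟧ v))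
    φ-represents (false ∷ a) = trans (ψ-represents a) (sym (F-split false (ℓ (false ∷ a)) (⟦ ψ ⟧ a)))
    φ-represents (true ∷ a)  = begin
      g (true ∷ a)
        ≡⟨ cong (g ∘ (true ∷_)) (⊕-identityˡ a) ⟨
      g (e₀ ⊕ (false ∷ a))
        ≡⟨ QuadraticForm.F-⊕ g-quad e₀ (false ∷ a) ⟩
      polar g e₀ (false ∷ a) xor (g e₀ xor g (false ∷ a))
        ≡⟨ solve 3 (λ p q r → p :+ (q :+ r) := (q :+ p) :+ r) refl _ (g e₀) _ ⟩
      ℓ (true ∷ a) xor g (false ∷ a)
        ≡⟨ cong (ℓ (true ∷ a) xor_) (ψ-represents a) ⟩
      ℓ (true ∷ a) xor restriction (⟦ ψ ⟧ a)
        ≡⟨ F-split true (ℓ (true ∷ a)) (⟦ ψ ⟧ a) ⟨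
      F (⟦ split ⟧ (true ∷ ℓ (true ∷ a) ∷ ⟦ ψ ⟧ a))
        ∎
      where open ≡-Reasoning

represents : ∀ k m {n} {F : F₂^ n → Bool} {g : F₂^ k → Bool} → suc (k + m) ≤ n →
  IsQuadratic F → NoVanishingSubspace F m → IsQuadratic g → Represents F g
represents zero    m       _ F-quad _     g-quad =
  pad z≤n , λ { [] → trans (vanishes-0 g-quad) (sym (vanishes-0 F-quad)) }
represents (suc k) zero    _ F-quad noVan _      = ⊥-elim (noVan (pad z≤n) λ _ → vanishes-0 F-quad)
represents (suc k) (suc m) (s≤s (s≤s k+1+m≤e)) F-quad noVan g-quad =
  represents-suc g-quad
    (represents k m (≤-trans (≤-reflexive (sym (+-suc k m))) k+1+m≤e)
      restriction-quadratic (restriction-noVanishing noVan) (∘-quadratic g-quad λ _ _ → refl))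
  where
  open Splitting F-quad (Hyperbolic.hyperbolicPair F-quad noVan (≤-trans (m≤n+m (suc m) k) k+1+m≤e))

avoidingFlat : ∀ {m} (M : Matroid) (U : m ↪ dim M) → (∀ a → E M (⟦ U ⟧ a) ≡ false) → HasAvoidingFlat M m
avoidingFlat M U U-avoids =
  let A , A-injective , A≗U = toLinMap U in A , A-injective , λ a → trans (cong (E M) (A≗U a)) (U-avoids a)

inducedRestriction : (N M : Matroid) → Represents (E M) (E N) → InducedRestriction N M
inducedRestriction N M (φ , φ-represents) =
  let A , A-injective , A≗φ = toLinMap φ in
  A , A-injective , λ a _ → trans (φ-represents a) (cong (E M) (sym (A≗φ a)))

theorem4p7 : (M N : Matroid) → InE3 M → InE3 N → (c : ℕ) → IsCriticalNumber M c →
    dim N + 4 ≤ c → InducedRestriction N M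
-- Only χ(M) ≥ dim N + 2 is needed.
theorem4p7 M N M-E3 N-E3 c (c≤n , _ , no-avoiding-flat) k+4≤c =
  inducedRestriction N M
    (represents k (n ∸ suc k) (≤-reflexive (m+[n∸m]≡n k<n))
      (InE3⇒quadratic M M-E3) no-vanishing (InE3⇒quadratic N N-E3))
  where
  k = dim N
  n = dim M
  k+2≤c : suc (suc k) ≤ c
  k+2≤c = ≤-trans (≤-reflexive (+-comm 2 k)) (≤-trans (+-monoʳ-≤ k (s≤s (s≤s z≤n))) k+4≤c)
  k<n : suc k ≤ n
  k<n = ≤-trans (n≤1+n (suc k)) (≤-trans k+2≤c c≤n)
  no-vanishing : NoVanishingSubspace (E M) (n ∸ suc k)
  no-vanishing U U-avoids = no-avoiding-flat (suc k) k+2≤c (avoidingFlat M U U-avoids)
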